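{- Let $G$ be an undirected unweighted graph with $n$ vertices, let $\sigma\ge1$, let $s,t$ be vertices with a fixed shortest $s$–$t$ path, and let $e=(u,v)$ be a near edge on this path, with $u$ closer to $s$ than $v$. Let $P$ be a shortest replacement path from $s$ to $t$ avoiding $e$ such that $|P|>|su|+2\sqrt{n/\sigma}\,\log n$. Then $|\textsc{Suffix}(P)|>2\sqrt{n/\sigma}\,\log n$.
   Context: A shortest replacement path from $s$ to $t$ avoiding $e$ is a shortest $s$–$t$ path in $G\setminus\{e\}$; $|\cdot|$ denotes path length (number of edges) and $|su|$ is the distance from $s$ to $u$. $\textsc{Suffix}(P)$ is the subpath of $P$ starting at the vertex where $P$ leaves the fixed $s$–$t$ shortest path, ending at $t$. An edge on the $s$–$t$ path is near if its distance from $t$ along that path is less than $2\sqrt{n/\sigma}\,\log n$. -}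

module Defs where

open import Data.Nat using (ℕ; zero; suc; _∸_; _≤_; _<_)
open import Data.Fin using (Fin; _≟_)
open import Data.List using (List; []; _∷_; length; drop; head; last)
open import Data.Maybe using (Maybe; just)
open import Data.Product using (_×_; ∃)
open import Data.Sum using (_⊎_)
open import Data.Unit using (⊤)
open import Relation.Nullary using (¬_; yes; no)
open import Relation.Binary.PropositionalEquality using (_≡_)

record Graph (n : ℕ) : Set₁ where
  field
    Adj    : Fin n → Fin n → Set
    sym    : ∀ {x y} → Adj x y → Adj y x
    irrefl : ∀ {x} → ¬ Adj x x
open Graph public

AdjChain : ∀ {n} → (Fin n → Fin n → Set) → List (Fin n) → Set
AdjChain R []            = ⊤
AdjChain R (x ∷ [])      = ⊤
AdjChain R (x ∷ y ∷ xs)  = R x y × AdjChain R (y ∷ xs)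

IsWalk : ∀ {n} → (Fin n → Fin n → Set) → Fin n → Fin n → List (Fin n) → Set
IsWalk R s t p = AdjChain R p × head p ≡ just s × last p ≡ just t

len : ∀ {n} → List (Fin n) → ℕ
len p = length p ∸ 1

IsShortest : ∀ {n} → (Fin n → Fin n → Set) → Fin n → Fin n → List (Fin n) → Set
IsShortest R s t p = IsWalk R s t p × (∀ q → IsWalk R s t q → len p ≤ len q)

IsDist : ∀ {n} → (Fin n → Fin n → Set) → Fin n → Fin n → ℕ → Set
IsDist R s u d = (∃ λ p → IsWalk R s u p × len p ≡ d) × (∀ p → IsWalk R s u p → d ≤ len p)

Without : ∀ {n} → Graph n → Fin n → Fin n → Fin n → Fin n → Set
Without G u v x y = Adj G x y × ¬ (x ≡ u × y ≡ v) × ¬ (x ≡ v × y ≡ u)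

lcp : ∀ {n} → List (Fin n) → List (Fin n) → ℕ
lcp []       _        = 0
lcp (_ ∷ _)  []       = 0
lcp (x ∷ xs) (y ∷ ys) with x ≟ y
... | yes _ = suc (lcp xs ys)
... | no  _ = 0

-- Suffix(P): subpath of P from the vertex where P leaves the fixed path Π
-- (the last vertex of the common prefix of P and Π) to the end of P.
Suffix : ∀ {n} → List (Fin n) → List (Fin n) → List (Fin n)
Suffix Π P = drop (lcp P Π ∸ 1) P

-- A nonnegative real threshold L, represented through the only data the
-- statement uses for comparisons with natural numbers:
-- fl = ⌊L⌋ and ce = ⌈L⌉  (so  k > L ⇔ fl < k  and  k < L ⇔ k < ce).
record Threshold : Set where
  field
    fl : ℕ
    ce : ℕ
    ce-spec : ce ≡ fl ⊎ ce ≡ suc fl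
open Threshold public

module Submission where

-- Let e = (u,v) sit at position i of the fixed shortest
-- s–t path Π, i.e. drop i Π ≡ u ∷ v ∷ rest, and let P avoid e.
--   (1) Position is at most distance: splicing a shortest s–u walk q in front
--       of the part of Π after u gives an s–t walk of length |q| + (|Π| − i),
--       so minimality of Π forces i ≤ |su|.
--   (2) P leaves Π no later than at u: a walk that does not use the edge
--       (u,v) shares at most the first i + 1 vertices with Π, so Suffix(P)
--       drops at most i vertices of P and |Suffix(P)| ≥ |P| − i.
--   (3) Hence |Suffix(P)| ≥ |P| − i ≥ |P| − |su| > ⌊L⌋.

open import Defs hiding (sym)
open import Data.Nat using (ℕ; zero; suc; _+_; _∸_; _<_; _≤_; z≤n; s≤s)
open import Data.Nat.Properties
  using (≤-trans; +-comm; +-suc; +-monoʳ-≤; +-cancelʳ-≤; ∸-monoʳ-≤; ∸-monoˡ-≤;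
         ∸-+-assoc; m+n≤o⇒m≤o∸n)
open import Data.Fin using (Fin; _≟_)
open import Data.List using (List; []; _∷_; drop; _++_; length; head; last)
open import Data.List.Properties using (length-drop; length-++)
open import Data.Maybe using (just)
open import Data.Maybe.Properties using (just-injective)
open import Data.Product using (_,_; proj₁; proj₂)
open import Data.Empty using (⊥-elim)
open import Relation.Nullary using (¬_; yes; no)
open import Relation.Binary.PropositionalEquality
  using (_≡_; _≢_; refl; sym; trans; cong; subst; subst₂; module ≡-Reasoning)

module _ {n : ℕ} {R : Fin n → Fin n → Set} where

  chain-tail : ∀ x xs → AdjChain R (x ∷ xs) → AdjChain R xs
  chain-tail x []       _       = _
  chain-tail x (y ∷ xs) (_ , c) = c

  chain-drop : ∀ j (xs : List (Fin n)) → AdjChain R xs → AdjChain R (drop j xs)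
  chain-drop zero    xs       c = c
  chain-drop (suc j) []       c = c
  chain-drop (suc j) (x ∷ xs) c = chain-drop j xs (chain-tail x xs c)

  chain-splice : ∀ (q w : List (Fin n)) {u} → AdjChain R q → last q ≡ just u
               → AdjChain R (u ∷ w) → AdjChain R (q ++ w)
  chain-splice (x ∷ [])     w c  eq cw rewrite just-injective eq = cw
  chain-splice (x ∷ y ∷ ys) w (r , c) eq cw = r , chain-splice (y ∷ ys) w c eq cw

  last-splice : ∀ (q w : List (Fin n)) {u} → last q ≡ just u → last (q ++ w) ≡ last (u ∷ w)
  last-splice (x ∷ [])     w eq = cong (λ z → last (z ∷ w)) (just-injective eq)
  last-splice (x ∷ y ∷ ys) w eq = last-splice (y ∷ ys) w eq

  len-splice : ∀ (q w : List (Fin n)) {s} → head q ≡ just s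
             → len (q ++ w) ≡ len q + length w
  len-splice (x ∷ xs) w _ = length-++ xs

  walk-splice : ∀ {s u t} (q w : List (Fin n)) → IsWalk R s u q
              → AdjChain R (u ∷ w) → last (u ∷ w) ≡ just t → IsWalk R s t (q ++ w)
  walk-splice (x ∷ xs) w (cq , hq , lq) cw lw =
    chain-splice (x ∷ xs) w cq lq cw , hq , trans (last-splice (x ∷ xs) w lq) lw

  last-drop : ∀ i (xs : List (Fin n)) {y ys} → drop i xs ≡ y ∷ ys → last xs ≡ last (y ∷ ys)
  last-drop zero    xs           refl = refl
  last-drop (suc i) (x ∷ [])     eq   = ⊥-elim (drop-nil i eq)
    where
      drop-nil : ∀ {y ys} j → drop j [] ≢ y ∷ ys
      drop-nil zero    ()
      drop-nil (suc j) ()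
  last-drop (suc i) (x ∷ z ∷ zs) eq   = last-drop i (z ∷ zs) eq

  length-at : ∀ i (xs : List (Fin n)) {y ys} → drop i xs ≡ y ∷ ys
            → length xs ≡ i + length (y ∷ ys)
  length-at zero    xs       refl = refl
  length-at (suc i) (x ∷ xs) eq   = cong suc (length-at i xs eq)

  -- Step (1): the position of a vertex on a shortest s–t path is at most
  -- the length of any s–u walk, because the latter can replace the prefix.
  position≤distance : ∀ {s t u} (Π : List (Fin n)) → IsShortest R s t Π
                    → ∀ i {w} → drop i Π ≡ u ∷ w
                    → ∀ q → IsWalk R s u q → i ≤ len q
  position≤distance {u = u} Π ((cΠ , _ , lΠ) , minΠ) i {w} at q walk-q =
    +-cancelʳ-≤ (length w) i (len q) (subst₂ _≤_ lenΠ lenSpliced (minΠ (q ++ w) spliced))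
    where
      spliced : IsWalk R _ _ (q ++ w)
      spliced = walk-splice q w walk-q (subst (AdjChain R) at (chain-drop i Π cΠ))
                  (trans (sym (last-drop i Π at)) lΠ)
      lenΠ : len Π ≡ i + length w
      lenΠ = cong (_∸ 1) (trans (length-at i Π at) (+-suc i (length w)))
      lenSpliced : len (q ++ w) ≡ len q + length w
      lenSpliced = len-splice q w (proj₁ (proj₂ walk-q))

  prefix-bound : ∀ {u v rest} → ¬ R u v → ∀ i (P Π : List (Fin n))
               → drop i Π ≡ u ∷ v ∷ rest → AdjChain R P → lcp P Π ≤ suc i
  prefix-bound ¬uv zero [] _ refl _ = z≤n
  prefix-bound {u} ¬uv zero (x ∷ []) _ refl _ with x ≟ u
  ... | yes _ = s≤s z≤n
  ... | no  _ = z≤n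
  prefix-bound {u} {v} ¬uv zero (x ∷ y ∷ ys) _ refl (xy , _) with x ≟ u
  ... | no  _   = z≤n
  ... | yes x≡u with y ≟ v
  ...   | yes y≡v = ⊥-elim (¬uv (subst₂ R x≡u y≡v xy))
  ...   | no  _   = s≤s z≤n
  prefix-bound ¬uv (suc i) []      (y ∷ Π) _  _ = z≤n
  prefix-bound ¬uv (suc i) (x ∷ P) (y ∷ Π) at c with x ≟ y
  ... | no  _ = z≤n
  ... | yes _ = s≤s (prefix-bound ¬uv i P Π at (chain-tail x P c))

len-drop : ∀ {n} k (P : List (Fin n)) → len (drop k P) ≡ len P ∸ k
len-drop k P = begin
  length (drop k P) ∸ 1  ≡⟨ cong (_∸ 1) (length-drop k P) ⟩
  length P ∸ k ∸ 1       ≡⟨ ∸-+-assoc (length P) k 1 ⟩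
  length P ∸ (k + 1)     ≡⟨ cong (length P ∸_) (+-comm k 1) ⟩
  length P ∸ (1 + k)     ≡⟨ sym (∸-+-assoc (length P) 1 k) ⟩
  length P ∸ 1 ∸ k       ∎
  where open ≡-Reasoning

suffix-long : ∀ {n} i (Π P : List (Fin n)) → lcp P Π ≤ suc i → len P ∸ i ≤ len (Suffix Π P)
suffix-long i Π P shared =
  subst (len P ∸ i ≤_) (sym (len-drop (lcp P Π ∸ 1) P))
        (∸-monoʳ-≤ (len P) (∸-monoˡ-≤ 1 shared))

without-avoids : ∀ {n} (G : Graph n) (u v : Fin n) → ¬ Without G u v u v
without-avoids G u v (_ , not-uv , _) = not-uv (refl , refl)

lemma6 : (n : ℕ) (G : Graph n) (L : Threshold) (s t : Fin n) (Π : List (Fin n))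
    → IsShortest (Adj G) s t Π
    → (i : ℕ) (u v : Fin n) (rest : List (Fin n))
    → drop i Π ≡ u ∷ v ∷ rest
    → len Π ∸ suc i < ce L
    → (dsu : ℕ) → IsDist (Adj G) s u dsu
    → (P : List (Fin n)) → IsShortest (Without G u v) s t P
    → dsu + fl L < len P
    → fl L < len (Suffix Π P)
lemma6 n G L s t Π shortΠ i u v rest at _ dsu ((q , walk-q , len-q) , _) P ((cP , _) , _) longP =
  ≤-trans (m+n≤o⇒m≤o∸n (suc (fl L)) fl+i<P)
          (suffix-long i Π P (prefix-bound (without-avoids G u v) i P Π at cP))
  where
    i≤dsu : i ≤ dsu
    i≤dsu = subst (i ≤_) len-q (position≤distance Π shortΠ i at q walk-q)
    fl+i<P : suc (fl L) + i ≤ len P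
    fl+i<P = ≤-trans (s≤s (+-monoʳ-≤ (fl L) i≤dsu))
                     (subst (λ m → suc m ≤ len P) (+-comm dsu (fl L)) longP)
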